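{- Let $p$ be an odd prime and let $\mathcal{A}\subseteq\mathbb{F}_p$. Then \[|T_{2,2}(\mathcal{A}\times \mathcal{A})|\ge \frac{1}{6} (|\mathcal{A}|^2-2)\cdot |\Delta_{\mathbb{F}_p}(\mathcal{A}\times \mathcal{A})|.\]
   Context: For $\mathbf{x}=(x_1,x_2),\mathbf{y}=(y_1,y_2)\in\mathbb{F}_p^2$, $\|\mathbf{x}-\mathbf{y}\|=(x_1-y_1)^2+(x_2-y_2)^2$, and $\Delta_{\mathbb{F}_p}(\mathcal{E})=\{\|\mathbf{x}-\mathbf{y}\|:\mathbf{x},\mathbf{y}\in\mathcal{E}\}$ is the set of distinct distances determined by $\mathcal{E}\subseteq\mathbb{F}_p^2$. A triangle determined by $\mathcal{E}$ is a triple of vertices $(\mathbf{x}_1,\mathbf{x}_2,\mathbf{x}_3)$ with $\mathbf{x}_i\in\mathcal{E}$. Two triangles with vertices $(\mathbf{x}_1,\mathbf{x}_2,\mathbf{x}_3)$ and $(\mathbf{y}_1,\mathbf{y}_2,\mathbf{y}_3)$ are in the same congruence class if there exist an orthogonal $2\times 2$ matrix $\theta$ over $\mathbb{F}_p$ (i.e. $\theta\theta^T=I$) and $\mathbf{z}\in\mathbb{F}_p^2$ with $\mathbf{z}+\theta(\mathbf{x}_i)=\mathbf{y}_i$ for $i=1,2,3$. $T_{2,2}(\mathcal{E})$ denotes the set of congruence classes of triangles determined by points of $\mathcal{E}$. -}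

module Defs where

open import Data.Nat using (ℕ; zero; suc; _+_; _*_; ∣_-_∣)
open import Data.Nat.Divisibility using (_∣_; _∣?_)
open import Data.Fin using (Fin; toℕ)
open import Data.Fin.Subset using (Subset; _∈_)
open import Data.Fin.Subset.Properties using (_∈?_)
open import Data.Fin.Properties using (any?)
open import Data.Product using (Σ; ∃; _×_; _,_; proj₁; proj₂)
open import Data.List using (List; []; _∷_; length; filter; allFin; cartesianProduct)
open import Data.List.Relation.Unary.Any using (Any)
import Data.List.Relation.Unary.Any as Any
open import Relation.Nullary using (Dec; yes; no; ¬_)
open import Relation.Nullary.Decidable using (_×-dec_; map′; ¬?)

-- F_p is modelled as Fin p (an element is identified with its
-- representative toℕ x ∈ {0,…,p-1}); arithmetic is done in ℕ and
-- equations in F_p are congruences modulo p.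

infix 4 _≡_[mod_] _≡?_[mod_]

_≡_[mod_] : ℕ → ℕ → ℕ → Set
a ≡ b [mod p ] = p ∣ ∣ a - b ∣

_≡?_[mod_] : (a b p : ℕ) → Dec (a ≡ b [mod p ])
a ≡? b [mod p ] = p ∣? ∣ a - b ∣

Point : ℕ → Set
Point p = Fin p × Fin p

anyPair? : ∀ {p} {P : Fin p × Fin p → Set} →
           (∀ x → Dec (P x)) → Dec (∃ P)
anyPair? P? = map′ (λ { (i , j , q) → (i , j) , q })
                   (λ { ((i , j) , q) → i , j , q })
                   (any? (λ i → any? (λ j → P? (i , j))))

-- ‖x - y‖ = (x₁-y₁)² + (x₂-y₂)², computed on representatives
-- (|a - b|² = (a-b)², so the result is correct modulo p).
dist : ∀ {p} → Point p → Point p → ℕ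
dist (x₁ , x₂) (y₁ , y₂) = ∣ toℕ x₁ - toℕ y₁ ∣ * ∣ toℕ x₁ - toℕ y₁ ∣
                         + ∣ toℕ x₂ - toℕ y₂ ∣ * ∣ toℕ x₂ - toℕ y₂ ∣

InSq : ∀ {p} → Subset p → Point p → Set
InSq A (x₁ , x₂) = (x₁ ∈ A) × (x₂ ∈ A)

InSq? : ∀ {p} (A : Subset p) (x : Point p) → Dec (InSq A x)
InSq? A (x₁ , x₂) = (x₁ ∈? A) ×-dec (x₂ ∈? A)

InΔ : ∀ {p} → Subset p → Fin p → Set
InΔ {p} A d = Σ (Point p) λ x → Σ (Point p) λ y →
               InSq A x × InSq A y × (dist x y ≡ toℕ d [mod p ])

InΔ? : ∀ {p} (A : Subset p) (d : Fin p) → Dec (InΔ A d)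
InΔ? {p} A d = anyPair? λ x → anyPair? λ y →
  InSq? A x ×-dec InSq? A y ×-dec (dist x y ≡? toℕ d [mod p ])

numΔ : (p : ℕ) → Subset p → ℕ
numΔ p A = length (filter (InΔ? A) (allFin p))

Triangle : ℕ → Set
Triangle p = Point p × Point p × Point p

-- a 2×2 matrix θ = [[a , b] , [c , d]] over F_p
Mat : ℕ → Set
Mat p = (Fin p × Fin p) × (Fin p × Fin p)

IsOrth : ∀ {p} → Mat p → Set
IsOrth {p} ((a , b) , (c , d)) =
  (toℕ a * toℕ a + toℕ b * toℕ b ≡ 1 [mod p ]) ×
  (toℕ a * toℕ c + toℕ b * toℕ d ≡ 0 [mod p ]) ×
  (toℕ c * toℕ a + toℕ d * toℕ b ≡ 0 [mod p ]) ×
  (toℕ c * toℕ c + toℕ d * toℕ d ≡ 1 [mod p ])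

IsOrth? : ∀ {p} (θ : Mat p) → Dec (IsOrth θ)
IsOrth? {p} ((a , b) , (c , d)) =
  (toℕ a * toℕ a + toℕ b * toℕ b ≡? 1 [mod p ]) ×-dec
  (toℕ a * toℕ c + toℕ b * toℕ d ≡? 0 [mod p ]) ×-dec
  (toℕ c * toℕ a + toℕ d * toℕ b ≡? 0 [mod p ]) ×-dec
  (toℕ c * toℕ c + toℕ d * toℕ d ≡? 1 [mod p ])

Maps : ∀ {p} → Mat p → Point p → Point p → Point p → Set
Maps {p} ((a , b) , (c , d)) (z₁ , z₂) (x₁ , x₂) (y₁ , y₂) =
  (toℕ z₁ + (toℕ a * toℕ x₁ + toℕ b * toℕ x₂) ≡ toℕ y₁ [mod p ]) ×
  (toℕ z₂ + (toℕ c * toℕ x₁ + toℕ d * toℕ x₂) ≡ toℕ y₂ [mod p ])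

Maps? : ∀ {p} (θ : Mat p) (z x y : Point p) → Dec (Maps θ z x y)
Maps? {p} ((a , b) , (c , d)) (z₁ , z₂) (x₁ , x₂) (y₁ , y₂) =
  (toℕ z₁ + (toℕ a * toℕ x₁ + toℕ b * toℕ x₂) ≡? toℕ y₁ [mod p ]) ×-dec
  (toℕ z₂ + (toℕ c * toℕ x₁ + toℕ d * toℕ x₂) ≡? toℕ y₂ [mod p ])

Congruent : ∀ {p} → Triangle p → Triangle p → Set
Congruent {p} (x₁ , x₂ , x₃) (y₁ , y₂ , y₃) =
  Σ (Mat p) λ θ → IsOrth θ × Σ (Point p) λ z →
    Maps θ z x₁ y₁ × Maps θ z x₂ y₂ × Maps θ z x₃ y₃

Congruent? : ∀ {p} (s t : Triangle p) → Dec (Congruent s t)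
Congruent? (x₁ , x₂ , x₃) (y₁ , y₂ , y₃) =
  map′ (λ { (ab , cd , q) → (ab , cd) , q })
       (λ { ((ab , cd) , q) → ab , cd , q })
  (anyPair? λ ab → anyPair? λ cd → let θ = (ab , cd) in
    IsOrth? θ ×-dec anyPair? λ z →
      Maps? θ z x₁ y₁ ×-dec Maps? θ z x₂ y₂ ×-dec Maps? θ z x₃ y₃)

allPoints : (p : ℕ) → List (Point p)
allPoints p = cartesianProduct (allFin p) (allFin p)

triangles : (p : ℕ) → Subset p → List (Triangle p)
triangles p A =
  let ps = filter (InSq? A) (allPoints p) in
  cartesianProduct ps (cartesianProduct ps ps)

-- number of congruence classes meeting a list of triangles: each class
-- is counted once, at the last triangle of the list belonging to it.
numClasses : ∀ {p} → List (Triangle p) → ℕ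
numClasses [] = 0
numClasses (t ∷ ts) with Any.any? (λ s → Congruent? t s) ts
... | yes _ = numClasses ts
... | no  _ = suc (numClasses ts)

numT : (p : ℕ) → Subset p → ℕ
numT p A = numClasses (triangles p A)

module Submission where

-- Let K be the number of nonzero distances in Δ = Δ(A × A) and choose for
-- each of them a chord (x_d , y_d) of A × A realising it.  Every pair of such
-- a d and an apex z ∈ A × A gives the triangle (x_d , y_d , z).  Congruent
-- triangles have the same three side lengths, and a side-length triple is
-- produced by at most two pairs: the first side recovers d, and then z lies
-- on a circle about x_d and on one about y_d, which meet in at most two points
-- because ‖x_d − y_d‖ ≠ 0 and p is odd.  Hence K·|A|² ≤ 2|T|, and with
-- |Δ| ≤ K + 1 and K ≥ 1 (when |A| ≥ 2) the bound follows; we even get 1/4.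

open import Data.Nat using (ℕ; suc)
open import Data.Nat.Primality using (Prime)
open import Relation.Binary.PropositionalEquality using (_≢_)

module IntegerPlane where

  open import Data.Integer using (ℤ; +_; _+_; _*_; -_; _-_; 1ℤ)
  open import Data.Integer.Divisibility.Signed using (_∣_)
  open import Data.Integer.Tactic.RingSolver using (solve-∀)
  open import Data.Product using (_×_; _,_; proj₁; proj₂)
  open import Data.Sum using (_⊎_; inj₁; inj₂; [_,_]′)
  open import Data.Empty using (⊥-elim)
  open import Function using (id)
  open import Relation.Nullary using (¬_)
  open import Relation.Binary.PropositionalEquality using (_≡_; sym; subst)

  -- Congruences modulo an arbitrary integer P, handled as membership in the
  -- ideal Pℤ: every congruence below is certified by writing the target as
  -- an explicit ℤ-linear combination of the hypotheses (a ring identity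
  -- checked by the ring solver, which does not unfold sqNorm, so the
  -- identities are spelt out).  As x ≈ y unfolds to a subtraction, Agda cannot
  -- recover x and y from a proof, so they are passed explicitly where needed.
  module Ideal (P : ℤ) where
    open import Data.Integer.Divisibility.Signed using (∣m∣n⇒∣m+n; ∣n⇒∣m*n)

    infix 4 _≡0 _≈_
    infixl 6 _⊕_
    infixl 7 _⊛_

    _≡0 : ℤ → Set
    x ≡0 = P ∣ x

    _≈_ : ℤ → ℤ → Set
    x ≈ y = x - y ≡0

    _⊕_ : ∀ {x y} → x ≡0 → y ≡0 → x + y ≡0
    _⊕_ = ∣m∣n⇒∣m+n

    _⊛_ : ∀ c {x} → x ≡0 → c * x ≡0
    c ⊛ h = ∣n⇒∣m*n c h

    by : ∀ {x y} → x ≡ y → x ≡0 → y ≡0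
    by = subst _≡0

    ≈-sym : ∀ {x y} → x ≈ y → y ≈ x
    ≈-sym {x} {y} h = by (sym (identity x y)) ((- 1ℤ) ⊛ h)
      where
      identity : ∀ x y → y - x ≡ (- 1ℤ) * (x - y)
      identity = solve-∀

    ≈-trans : ∀ {x y z} → x ≈ y → y ≈ z → x ≈ z
    ≈-trans {x} {y} {z} h h′ = by (sym (identity x y z)) (1ℤ ⊛ h ⊕ 1ℤ ⊛ h′)
      where
      identity : ∀ x y z → x - z ≡ 1ℤ * (x - y) + 1ℤ * (y - z)
      identity = solve-∀

    sqNorm : ℤ → ℤ → ℤ
    sqNorm e₁ e₂ = e₁ * e₁ + e₂ * e₂

    dist² : ℤ × ℤ → ℤ × ℤ → ℤ
    dist² (x₁ , x₂) (y₁ , y₂) = sqNorm (x₁ - y₁) (x₂ - y₂)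

    dist²-comm : ∀ x y → dist² x y ≡ dist² y x
    dist²-comm (x₁ , x₂) (y₁ , y₂) = identity x₁ x₂ y₁ y₂
      where
      identity : ∀ x₁ x₂ y₁ y₂ →
        (x₁ - y₁) * (x₁ - y₁) + (x₂ - y₂) * (x₂ - y₂) ≡ (y₁ - x₁) * (y₁ - x₁) + (y₂ - x₂) * (y₂ - x₂)
      identity = solve-∀

    -- Writing δ = det θ, the rows give
    -- a ≡ dδ, b ≡ -cδ and δ² ≡ 1, from which the columns are computed.
    orthonormal-columns : ∀ a b c d →
      a * a + b * b ≈ 1ℤ → a * c + b * d ≡0 → c * c + d * d ≈ 1ℤ →
      (a * a + c * c ≈ 1ℤ) × (a * b + c * d ≡0) × (b * b + d * d ≈ 1ℤ)
    orthonormal-columns a b c d r₁ r₁₂ r₂ =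
      by (sym (col₁ a b c d)) ((a + d * δ) ⊛ a≈dδ ⊕ (d * d) ⊛ δ²≈1 ⊕ 1ℤ ⊛ r₂) ,
      by (sym (col₁₂ a b c d))
         ((- (c * d)) ⊛ δ²≈1 ⊕ (d * δ) ⊛ b≈-cδ ⊕ (- (c * δ)) ⊛ a≈dδ ⊕ (a - d * δ) ⊛ b≈-cδ) ,
      by (sym (col₂ a b c d)) ((b - c * δ) ⊛ b≈-cδ ⊕ (c * c) ⊛ δ²≈1 ⊕ 1ℤ ⊛ r₂)
      where
      δ = a * d - b * c
      a≈dδ : a - d * δ ≡0
      a≈dδ = by (sym (det₁ a b c d)) ((- a) ⊛ r₂ ⊕ c ⊛ r₁₂)
        where
        det₁ : ∀ a b c d → a - d * (a * d - b * c) ≡ (- a) * (c * c + d * d - 1ℤ) + c * (a * c + b * d)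
        det₁ = solve-∀
      b≈-cδ : b + c * δ ≡0
      b≈-cδ = by (sym (det₂ a b c d)) (d ⊛ r₁₂ ⊕ (- b) ⊛ r₂)
        where
        det₂ : ∀ a b c d → b + c * (a * d - b * c) ≡ d * (a * c + b * d) + (- b) * (c * c + d * d - 1ℤ)
        det₂ = solve-∀
      δ²≈1 : δ * δ ≈ 1ℤ
      δ²≈1 = by (sym (det² a b c d)) ((c * c + d * d - 1ℤ) ⊛ r₁ ⊕ 1ℤ ⊛ r₁ ⊕ 1ℤ ⊛ r₂ ⊕ (- (a * c + b * d)) ⊛ r₁₂)
        where
        det² : ∀ a b c d → (a * d - b * c) * (a * d - b * c) - 1ℤ ≡
          (c * c + d * d - 1ℤ) * (a * a + b * b - 1ℤ) + 1ℤ * (a * a + b * b - 1ℤ)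
          + 1ℤ * (c * c + d * d - 1ℤ) + (- (a * c + b * d)) * (a * c + b * d)
        det² = solve-∀
      col₁ : ∀ a b c d → a * a + c * c - 1ℤ ≡
        (a + d * (a * d - b * c)) * (a - d * (a * d - b * c))
        + (d * d) * ((a * d - b * c) * (a * d - b * c) - 1ℤ) + 1ℤ * (c * c + d * d - 1ℤ)
      col₁ = solve-∀
      col₂ : ∀ a b c d → b * b + d * d - 1ℤ ≡
        (b - c * (a * d - b * c)) * (b + c * (a * d - b * c))
        + (c * c) * ((a * d - b * c) * (a * d - b * c) - 1ℤ) + 1ℤ * (c * c + d * d - 1ℤ)
      col₂ = solve-∀
      col₁₂ : ∀ a b c d → a * b + c * d ≡
        (- (c * d)) * ((a * d - b * c) * (a * d - b * c) - 1ℤ)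
        + (d * (a * d - b * c)) * (b + c * (a * d - b * c))
        + (- (c * (a * d - b * c))) * (a - d * (a * d - b * c))
        + (a - d * (a * d - b * c)) * (b + c * (a * d - b * c))
      col₁₂ = solve-∀

    orthogonal-preserves-norm : ∀ a b c d e₁ e₂ →
      a * a + c * c ≈ 1ℤ → a * b + c * d ≡0 → b * b + d * d ≈ 1ℤ →
      sqNorm (a * e₁ + b * e₂) (c * e₁ + d * e₂) ≈ sqNorm e₁ e₂
    orthogonal-preserves-norm a b c d e₁ e₂ c₁ c₁₂ c₂ =
      by (sym (identity a b c d e₁ e₂))
         ((e₁ * e₁) ⊛ c₁ ⊕ (+ 2 * e₁ * e₂) ⊛ c₁₂ ⊕ (e₂ * e₂) ⊛ c₂)
      where
      identity : ∀ a b c d e₁ e₂ →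
        (a * e₁ + b * e₂) * (a * e₁ + b * e₂) + (c * e₁ + d * e₂) * (c * e₁ + d * e₂) - (e₁ * e₁ + e₂ * e₂)
        ≡ (e₁ * e₁) * (a * a + c * c - 1ℤ) + (+ 2 * e₁ * e₂) * (a * b + c * d) + (e₂ * e₂) * (b * b + d * d - 1ℤ)
      identity = solve-∀

    sqNorm-cong : ∀ {u₁ u₂ v₁ v₂} → u₁ ≈ v₁ → u₂ ≈ v₂ → sqNorm u₁ u₂ ≈ sqNorm v₁ v₂
    sqNorm-cong {u₁} {u₂} {v₁} {v₂} h₁ h₂ =
      by (sym (identity u₁ u₂ v₁ v₂)) ((u₁ + v₁) ⊛ h₁ ⊕ (u₂ + v₂) ⊛ h₂)
      where
      identity : ∀ u₁ u₂ v₁ v₂ → u₁ * u₁ + u₂ * u₂ - (v₁ * v₁ + v₂ * v₂)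
        ≡ (u₁ + v₁) * (u₁ - v₁) + (u₂ + v₂) * (u₂ - v₂)
      identity = solve-∀

    affine-difference : ∀ z a b x₁ x₂ x₁′ x₂′ y y′ →
      z + (a * x₁ + b * x₂) ≈ y → z + (a * x₁′ + b * x₂′) ≈ y′ →
      a * (x₁ - x₁′) + b * (x₂ - x₂′) ≈ y - y′
    affine-difference z a b x₁ x₂ x₁′ x₂′ y y′ h h′ =
      by (sym (identity z a b x₁ x₂ x₁′ x₂′ y y′)) (1ℤ ⊛ h ⊕ (- 1ℤ) ⊛ h′)
      where
      identity : ∀ z a b x₁ x₂ x₁′ x₂′ y y′ →
        a * (x₁ - x₁′) + b * (x₂ - x₂′) - (y - y′)
        ≡ 1ℤ * (z + (a * x₁ + b * x₂) - y) + (- 1ℤ) * (z + (a * x₁′ + b * x₂′) - y′)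
      identity = solve-∀

    isometry-preserves-distance : ∀ a b c d z₁ z₂ x₁ x₂ x₁′ x₂′ y₁ y₂ y₁′ y₂′ →
      a * a + b * b ≈ 1ℤ → a * c + b * d ≡0 → c * c + d * d ≈ 1ℤ →
      z₁ + (a * x₁ + b * x₂) ≈ y₁ → z₂ + (c * x₁ + d * x₂) ≈ y₂ →
      z₁ + (a * x₁′ + b * x₂′) ≈ y₁′ → z₂ + (c * x₁′ + d * x₂′) ≈ y₂′ →
      sqNorm (x₁ - x₁′) (x₂ - x₂′) ≈ sqNorm (y₁ - y₁′) (y₂ - y₂′)
    isometry-preserves-distance a b c d z₁ z₂ x₁ x₂ x₁′ x₂′ y₁ y₂ y₁′ y₂′ r₁ r₁₂ r₂ m₁ m₂ m₁′ m₂′ =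
      ≈-trans {sqNorm e₁ e₂} {sqNorm θe₁ θe₂} {sqNorm (y₁ - y₁′) (y₂ - y₂′)}
        (≈-sym {sqNorm θe₁ θe₂} {sqNorm e₁ e₂} (orthogonal-preserves-norm a b c d e₁ e₂ c₁ c₁₂ c₂))
        (sqNorm-cong {θe₁} {θe₂} {y₁ - y₁′} {y₂ - y₂′}
          (affine-difference z₁ a b x₁ x₂ x₁′ x₂′ y₁ y₁′ m₁ m₁′)
          (affine-difference z₂ c d x₁ x₂ x₁′ x₂′ y₂ y₂′ m₂ m₂′))
      where
      e₁ = x₁ - x₁′
      e₂ = x₂ - x₂′
      θe₁ = a * e₁ + b * e₂
      θe₂ = c * e₁ + d * e₂
      columns = orthonormal-columns a b c d r₁ r₁₂ r₂
      c₁ = proj₁ columns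
      c₁₂ = proj₁ (proj₂ columns)
      c₂ = proj₂ (proj₂ columns)

  -- Over a prime modulus P ≠ 2, two "circles" with centres x, y such that
  -- ‖x − y‖ ≢ 0 meet in at most two points.  In the frame formed by y − x and
  -- its normal, equal distances to x and to y force the tangential coordinates
  -- of the common points to agree (this divides by 2) and their normal
  -- coordinates to agree up to sign; among three points two signs coincide.
  module TwoCircles (P : ℤ)
      (euclid : ∀ x y → P ∣ x * y → P ∣ x ⊎ P ∣ y) (P∤2 : ¬ P ∣ + 2) where
    open Ideal P

    cancel : ∀ {u e} → ¬ u ≡0 → u * e ≡0 → e ≡0
    cancel u≢0 h = [ (λ u≡0 → ⊥-elim (u≢0 u≡0)) , id ]′ (euclid _ _ h)

    Equidistant : ℤ × ℤ → ℤ × ℤ → ℤ × ℤ → Set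
    Equidistant o p q = dist² o p ≈ dist² o q

    equidistant-trans : ∀ o a b c → Equidistant o a b → Equidistant o a c → Equidistant o b c
    equidistant-trans o a b c ab ac =
      ≈-trans {dist² o b} {dist² o a} {dist² o c} (≈-sym {dist² o a} {dist² o b} ab) ac

    _≈²_ : ℤ × ℤ → ℤ × ℤ → Set
    (p₁ , p₂) ≈² (q₁ , q₂) = (p₁ ≈ q₁) × (p₂ ≈ q₂)

    module Centres (x₁ x₂ y₁ y₂ : ℤ) (x≉y : ¬ dist² (x₁ , x₂) (y₁ , y₂) ≡0) where
      x y : ℤ × ℤ
      x = x₁ , x₂
      y = y₁ , y₂

      along : ℤ × ℤ → ℤ × ℤ → ℤ
      along (p₁ , p₂) (q₁ , q₂) = (p₁ - q₁) * (y₁ - x₁) + (p₂ - q₂) * (y₂ - x₂)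

      -- the cross product (y − x) × (p − x): the normal coordinate of p
      offset : ℤ × ℤ → ℤ
      offset (p₁ , p₂) = (y₁ - x₁) * (p₂ - x₂) - (y₂ - x₂) * (p₁ - x₁)

      along≡0 : ∀ p q → Equidistant x p q → Equidistant y p q → along p q ≡0
      along≡0 (p₁ , p₂) (q₁ , q₂) hx hy =
        cancel P∤2 (by (sym (identity x₁ x₂ y₁ y₂ p₁ p₂ q₁ q₂)) (1ℤ ⊛ hx ⊕ (- 1ℤ) ⊛ hy))
        where
        identity : ∀ x₁ x₂ y₁ y₂ p₁ p₂ q₁ q₂ →
          + 2 * ((p₁ - q₁) * (y₁ - x₁) + (p₂ - q₂) * (y₂ - x₂)) ≡
          1ℤ * (((x₁ - p₁) * (x₁ - p₁) + (x₂ - p₂) * (x₂ - p₂)) - ((x₁ - q₁) * (x₁ - q₁) + (x₂ - q₂) * (x₂ - q₂)))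
          + (- 1ℤ) * (((y₁ - p₁) * (y₁ - p₁) + (y₂ - p₂) * (y₂ - p₂)) - ((y₁ - q₁) * (y₁ - q₁) + (y₂ - q₂) * (y₂ - q₂)))
        identity = solve-∀

      -- then, by Pythagoras about x, the normal coordinates agree up to sign
      offset-± : ∀ p q → Equidistant x p q → along p q ≡0 →
                 offset p ≈ offset q ⊎ offset p + offset q ≡0
      offset-± (p₁ , p₂) (q₁ , q₂) hx h⊥ = euclid _ _
        (by (sym (identity x₁ x₂ y₁ y₂ p₁ p₂ q₁ q₂))
            (sqNorm (y₁ - x₁) (y₂ - x₂) ⊛ hx
             ⊕ (- ((p₁ - x₁) * (y₁ - x₁) + (p₂ - x₂) * (y₂ - x₂)
                   + ((q₁ - x₁) * (y₁ - x₁) + (q₂ - x₂) * (y₂ - x₂)))) ⊛ h⊥))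
        where
        identity : ∀ x₁ x₂ y₁ y₂ p₁ p₂ q₁ q₂ →
          ((y₁ - x₁) * (p₂ - x₂) - (y₂ - x₂) * (p₁ - x₁) - ((y₁ - x₁) * (q₂ - x₂) - (y₂ - x₂) * (q₁ - x₁)))
          * ((y₁ - x₁) * (p₂ - x₂) - (y₂ - x₂) * (p₁ - x₁) + ((y₁ - x₁) * (q₂ - x₂) - (y₂ - x₂) * (q₁ - x₁)))
          ≡ ((y₁ - x₁) * (y₁ - x₁) + (y₂ - x₂) * (y₂ - x₂)) * (((x₁ - p₁) * (x₁ - p₁) + (x₂ - p₂) * (x₂ - p₂)) - ((x₁ - q₁) * (x₁ - q₁) + (x₂ - q₂) * (x₂ - q₂)))
            + (- ((p₁ - x₁) * (y₁ - x₁) + (p₂ - x₂) * (y₂ - x₂) + ((q₁ - x₁) * (y₁ - x₁) + (q₂ - x₂) * (y₂ - x₂))))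
              * ((p₁ - q₁) * (y₁ - x₁) + (p₂ - q₂) * (y₂ - x₂))
        identity = solve-∀

      coincide : ∀ p q → along p q ≡0 → offset p ≈ offset q → p ≈² q
      coincide (p₁ , p₂) (q₁ , q₂) h⊥ h∥ =
        cancel u≢0 (by (sym (first x₁ x₂ y₁ y₂ p₁ p₂ q₁ q₂)) ((y₁ - x₁) ⊛ h⊥ ⊕ (- (y₂ - x₂)) ⊛ h∥)) ,
        cancel u≢0 (by (sym (second x₁ x₂ y₁ y₂ p₁ p₂ q₁ q₂)) ((y₂ - x₂) ⊛ h⊥ ⊕ (y₁ - x₁) ⊛ h∥))
        where
        u≢0 : ¬ sqNorm (y₁ - x₁) (y₂ - x₂) ≡0
        u≢0 h = x≉y (by (dist²-comm y x) h)
        first : ∀ x₁ x₂ y₁ y₂ p₁ p₂ q₁ q₂ → ((y₁ - x₁) * (y₁ - x₁) + (y₂ - x₂) * (y₂ - x₂)) * (p₁ - q₁) ≡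
          (y₁ - x₁) * ((p₁ - q₁) * (y₁ - x₁) + (p₂ - q₂) * (y₂ - x₂))
          + (- (y₂ - x₂)) * ((y₁ - x₁) * (p₂ - x₂) - (y₂ - x₂) * (p₁ - x₁) - ((y₁ - x₁) * (q₂ - x₂) - (y₂ - x₂) * (q₁ - x₁)))
        first = solve-∀
        second : ∀ x₁ x₂ y₁ y₂ p₁ p₂ q₁ q₂ → ((y₁ - x₁) * (y₁ - x₁) + (y₂ - x₂) * (y₂ - x₂)) * (p₂ - q₂) ≡
          (y₂ - x₂) * ((p₁ - q₁) * (y₁ - x₁) + (p₂ - q₂) * (y₂ - x₂))
          + (y₁ - x₁) * ((y₁ - x₁) * (p₂ - x₂) - (y₂ - x₂) * (p₁ - x₁) - ((y₁ - x₁) * (q₂ - x₂) - (y₂ - x₂) * (q₁ - x₁)))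
        second = solve-∀

      three-points : ∀ a b c →
        Equidistant x a b → Equidistant y a b → Equidistant x a c → Equidistant y a c →
        a ≈² b ⊎ a ≈² c ⊎ b ≈² c
      three-points a b c xab yab xac yac = cases (offset-± a b xab ⊥ab) (offset-± a c xac ⊥ac)
        where
        ⊥ab = along≡0 a b xab yab
        ⊥ac = along≡0 a c xac yac
        ⊥bc = along≡0 b c (equidistant-trans x a b c xab xac) (equidistant-trans y a b c yab yac)
        identity : ∀ a b c → b - c ≡ 1ℤ * (a + b) + (- 1ℤ) * (a + c)
        identity = solve-∀
        cases : offset a ≈ offset b ⊎ offset a + offset b ≡0 → offset a ≈ offset c ⊎ offset a + offset c ≡0 →
                a ≈² b ⊎ a ≈² c ⊎ b ≈² c
        cases (inj₁ ab) _          = inj₁ (coincide a b ⊥ab ab)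
        cases (inj₂ _)  (inj₁ ac)  = inj₂ (inj₁ (coincide a c ⊥ac ac))
        cases (inj₂ ab) (inj₂ ac)  = inj₂ (inj₂ (coincide b c ⊥bc
          (by (sym (identity (offset a) (offset b) (offset c))) (1ℤ ⊛ ab ⊕ (- 1ℤ) ⊛ ac))))

module ResidueArithmetic where
  open IntegerPlane

  open import Defs
  open import Data.Nat as ℕ using (ℕ; _≤_; z≤n; s≤s; _%_; _/_; _∸_; NonZero)
  open import Data.Nat.Properties using (m≤n⇒m≤1+n; ≤-total; ∣-∣-comm; m≤n⇒∣n-m∣≡n∸m; m∸n+n≡m; m+n∸m≡n)
  open import Data.Nat.DivMod using (%-congˡ; %-remove-+ˡ; m≡m%n+[m/n]*n; m%n≤m; m<n⇒m%n≡m)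
  open import Data.Nat.Divisibility as ℕD using (divides)
  open import Data.Integer as ℤ using (ℤ; +_; -[1+_])
  open import Data.Integer.Properties as ℤP using ([+m]-[+n]≡m⊖n; ∣⊖∣-≤; ∣m⊖n∣≡∣n⊖m∣; pos-*; pos-+)
  open import Data.Integer.Divisibility.Signed using (∣ᵤ⇒∣; ∣⇒∣ᵤ)
  open import Data.Fin using (Fin; toℕ)
  open import Data.Fin.Properties using (toℕ-injective; toℕ<n)
  open import Data.Product using (_×_; _,_)
  open import Data.Product.Properties using (≡-dec)
  open import Data.List using (List; []; _∷_; length)
  open import Data.List.Relation.Unary.Any using (here; there)
  import Data.List.Relation.Unary.Any as Any
  open import Data.List.Membership.Propositional using (_∈_; find)
  open import Relation.Nullary using (yes; no)
  open import Relation.Binary.Definitions using (DecidableEquality)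
  open import Data.Sum using (inj₁; inj₂)
  open import Data.Empty using (⊥-elim)
  open import Relation.Binary.PropositionalEquality

  module NatToInt where
    ∣+m-+n∣ : ∀ m n → ℤ.∣ + m ℤ.- + n ∣ ≡ ℕ.∣ m - n ∣
    ∣+m-+n∣ m n rewrite [+m]-[+n]≡m⊖n m n with ≤-total m n
    ... | inj₁ m≤n = trans (∣⊖∣-≤ m≤n) (trans (sym (m≤n⇒∣n-m∣≡n∸m m≤n)) (∣-∣-comm n m))
    ... | inj₂ n≤m = trans (∣m⊖n∣≡∣n⊖m∣ m n) (trans (∣⊖∣-≤ n≤m) (sym (m≤n⇒∣n-m∣≡n∸m n≤m)))

    ∣z∣²≡z² : ∀ z → + ℤ.∣ z ∣ ℤ.* + ℤ.∣ z ∣ ≡ z ℤ.* z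
    ∣z∣²≡z² (+ n)    = refl
    ∣z∣²≡z² -[1+ n ] = refl

    ∣m-n∣²-cast : ∀ m n → + (ℕ.∣ m - n ∣ ℕ.* ℕ.∣ m - n ∣) ≡ (+ m ℤ.- + n) ℤ.* (+ m ℤ.- + n)
    ∣m-n∣²-cast m n = begin
      + (ℕ.∣ m - n ∣ ℕ.* ℕ.∣ m - n ∣)   ≡⟨ pos-* ℕ.∣ m - n ∣ ℕ.∣ m - n ∣ ⟩
      + ℕ.∣ m - n ∣ ℤ.* + ℕ.∣ m - n ∣  ≡⟨ cong (λ k → + k ℤ.* + k) (sym (∣+m-+n∣ m n)) ⟩
      + ℤ.∣ d ∣ ℤ.* + ℤ.∣ d ∣          ≡⟨ ∣z∣²≡z² d ⟩
      d ℤ.* d                          ∎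
      where
      open ≡-Reasoning
      d = + m ℤ.- + n

    bilinear-cast : ∀ a b c d → + (a ℕ.* b ℕ.+ c ℕ.* d) ≡ + a ℤ.* + b ℤ.+ + c ℤ.* + d
    bilinear-cast a b c d = trans (pos-+ (a ℕ.* b) (c ℕ.* d)) (cong₂ ℤ._+_ (pos-* a b) (pos-* c d))

    affine-cast : ∀ m a b c d → + (m ℕ.+ (a ℕ.* b ℕ.+ c ℕ.* d)) ≡ + m ℤ.+ (+ a ℤ.* + b ℤ.+ + c ℤ.* + d)
    affine-cast m a b c d = trans (pos-+ m (a ℕ.* b ℕ.+ c ℕ.* d)) (cong (λ k → + m ℤ.+ k) (bilinear-cast a b c d))

  module Residues (p : ℕ) .{{_ : NonZero p}} where
    open NatToInt
    open Ideal (+ p)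

    ι : Fin p → ℤ
    ι i = + toℕ i

    ι² : Point p → ℤ × ℤ
    ι² (i , j) = ι i , ι j

    mod⇒≈ : ∀ a b → a ≡ b [mod p ] → + a ≈ + b
    mod⇒≈ a b h = ∣ᵤ⇒∣ (subst (p ℕD.∣_) (sym (∣+m-+n∣ a b)) h)

    ≈⇒mod : ∀ a b → + a ≈ + b → a ≡ b [mod p ]
    ≈⇒mod a b h = subst (p ℕD.∣_) (∣+m-+n∣ a b) (∣⇒∣ᵤ h)

    %-stable : ∀ {a b} → a ≤ b → p ℕD.∣ b ∸ a → b % p ≡ a % p
    %-stable {a} {b} a≤b h = trans (%-congˡ (sym (m∸n+n≡m a≤b))) (%-remove-+ˡ a h)

    mod⇒% : ∀ a b → a ≡ b [mod p ] → a % p ≡ b % p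
    mod⇒% a b h with ≤-total a b
    ... | inj₁ a≤b = sym (%-stable a≤b (subst (p ℕD.∣_) (trans (∣-∣-comm a b) (m≤n⇒∣n-m∣≡n∸m a≤b)) h))
    ... | inj₂ b≤a = %-stable b≤a (subst (p ℕD.∣_) (m≤n⇒∣n-m∣≡n∸m b≤a) h)

    ≡-% : ∀ a → a ≡ a % p [mod p ]
    ≡-% a = divides (a / p) (begin
      ℕ.∣ a - a % p ∣          ≡⟨ m≤n⇒∣n-m∣≡n∸m (m%n≤m a p) ⟩
      a ∸ a % p                 ≡⟨ cong (_∸ a % p) (m≡m%n+[m/n]*n a p) ⟩
      a % p ℕ.+ a / p ℕ.* p ∸ a % p ≡⟨ m+n∸m≡n (a % p) (a / p ℕ.* p) ⟩
      a / p ℕ.* p               ∎)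
      where open ≡-Reasoning

    %⇒mod : ∀ a b → a % p ≡ b % p → a ≡ b [mod p ]
    %⇒mod a b e = ≈⇒mod a b (≈-trans {+ a} {+ (a % p)} {+ b} (mod⇒≈ a (a % p) (≡-% a))
      (subst (λ r → + r ≈ + b) (sym e) (≈-sym {+ b} {+ (b % p)} (mod⇒≈ b (b % p) (≡-% b)))))

    ι-injective : ∀ i j → ι i ≈ ι j → i ≡ j
    ι-injective i j h = toℕ-injective (begin
      toℕ i          ≡⟨ sym (m<n⇒m%n≡m (toℕ<n i)) ⟩
      toℕ i % p      ≡⟨ mod⇒% (toℕ i) (toℕ j) (≈⇒mod (toℕ i) (toℕ j) h) ⟩
      toℕ j % p      ≡⟨ m<n⇒m%n≡m (toℕ<n j) ⟩
      toℕ j          ∎)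
      where open ≡-Reasoning

    dist-ι : ∀ x y → + dist x y ≡ dist² (ι² x) (ι² y)
    dist-ι (x₁ , x₂) (y₁ , y₂) = trans (pos-+ (δ₁ ℕ.* δ₁) (δ₂ ℕ.* δ₂))
      (cong₂ ℤ._+_ (∣m-n∣²-cast (toℕ x₁) (toℕ y₁)) (∣m-n∣²-cast (toℕ x₂) (toℕ y₂)))
      where
      δ₁ = ℕ.∣ toℕ x₁ - toℕ y₁ ∣
      δ₂ = ℕ.∣ toℕ x₂ - toℕ y₂ ∣

    %⇒dist²≈ : ∀ x x′ y y′ → dist x x′ % p ≡ dist y y′ % p →
               dist² (ι² x) (ι² x′) ≈ dist² (ι² y) (ι² y′)
    %⇒dist²≈ x x′ y y′ e = by (cong₂ ℤ._-_ (dist-ι x x′) (dist-ι y y′)) (mod⇒≈ d d′ (%⇒mod d d′ e))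
      where
      d = dist x x′
      d′ = dist y y′

    dist²≈⇒% : ∀ x x′ y y′ → dist² (ι² x) (ι² x′) ≈ dist² (ι² y) (ι² y′) →
               dist x x′ % p ≡ dist y y′ % p
    dist²≈⇒% x x′ y y′ h = mod⇒% d d′ (≈⇒mod d d′ (by (sym (cong₂ ℤ._-_ (dist-ι x x′) (dist-ι y y′))) h))
      where
      d = dist x x′
      d′ = dist y y′

    bilinear-mod : ∀ a b c d e → a ℕ.* b ℕ.+ c ℕ.* d ≡ e [mod p ] → + a ℤ.* + b ℤ.+ + c ℤ.* + d ≈ + e
    bilinear-mod a b c d e h = by (cong (ℤ._- + e) (bilinear-cast a b c d)) (mod⇒≈ (a ℕ.* b ℕ.+ c ℕ.* d) e h)

    affine-mod : ∀ m a b c d e → m ℕ.+ (a ℕ.* b ℕ.+ c ℕ.* d) ≡ e [mod p ] →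
                 + m ℤ.+ (+ a ℤ.* + b ℤ.+ + c ℤ.* + d) ≈ + e
    affine-mod m a b c d e h = by (cong (ℤ._- + e) (affine-cast m a b c d)) (mod⇒≈ (m ℕ.+ (a ℕ.* b ℕ.+ c ℕ.* d)) e h)

    isometry-preserves-dist : ∀ θ z {x x′ y y′} → IsOrth θ → Maps θ z x y → Maps θ z x′ y′ →
                              dist x x′ % p ≡ dist y y′ % p
    isometry-preserves-dist ((a , b) , (c , d)) (z₁ , z₂) {x₁ , x₂} {x₁′ , x₂′} {y₁ , y₂} {y₁′ , y₂′}
                            (o₁ , o₁₂ , _ , o₂) (m₁ , m₂) (m₁′ , m₂′) =
      dist²≈⇒% (x₁ , x₂) (x₁′ , x₂′) (y₁ , y₂) (y₁′ , y₂′)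
        (isometry-preserves-distance (ι a) (ι b) (ι c) (ι d) (ι z₁) (ι z₂)
          (ι x₁) (ι x₂) (ι x₁′) (ι x₂′) (ι y₁) (ι y₂) (ι y₁′) (ι y₂′)
          (bilinear-mod (toℕ a) (toℕ a) (toℕ b) (toℕ b) 1 o₁)
          (by (ℤP.+-identityʳ (ι a ℤ.* ι c ℤ.+ ι b ℤ.* ι d)) (bilinear-mod (toℕ a) (toℕ c) (toℕ b) (toℕ d) 0 o₁₂))
          (bilinear-mod (toℕ c) (toℕ c) (toℕ d) (toℕ d) 1 o₂)
          (affine-mod (toℕ z₁) (toℕ a) (toℕ x₁) (toℕ b) (toℕ x₂) (toℕ y₁) m₁)
          (affine-mod (toℕ z₂) (toℕ c) (toℕ x₁) (toℕ d) (toℕ x₂) (toℕ y₂) m₂)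
          (affine-mod (toℕ z₁) (toℕ a) (toℕ x₁′) (toℕ b) (toℕ x₂′) (toℕ y₁′) m₁′)
          (affine-mod (toℕ z₂) (toℕ c) (toℕ x₁′) (toℕ d) (toℕ x₂′) (toℕ y₂′) m₂′))

    Sides : Set
    Sides = ℕ × ℕ × ℕ

    sides : Triangle p → Sides
    sides (a , b , c) = dist a b % p , dist a c % p , dist b c % p

    congruent⇒same-sides : ∀ {t s} → Congruent t s → sides t ≡ sides s
    congruent⇒same-sides (θ , orth , z , m₁ , m₂ , m₃) =
      cong₂ _,_ (isometry-preserves-dist θ z orth m₁ m₂)
        (cong₂ _,_ (isometry-preserves-dist θ z orth m₁ m₃) (isometry-preserves-dist θ z orth m₂ m₃))

    _≟ˢ_ : DecidableEquality Sides
    _≟ˢ_ = ≡-dec ℕ._≟_ (≡-dec ℕ._≟_ ℕ._≟_)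

    -- the side triples of the congruence classes met by a list of triangles,
    -- each recorded at the last triangle of its class, as numClasses counts them
    sideTriples : List (Triangle p) → List Sides
    sideTriples [] = []
    sideTriples (t ∷ ts) with Any.any? (λ s → sides t ≟ˢ sides s) ts
    ... | yes _ = sideTriples ts
    ... | no _  = sides t ∷ sideTriples ts

    -- distinct side triples come from distinct congruence classes
    sideTriples≤numClasses : ∀ ts → length (sideTriples ts) ≤ numClasses ts
    sideTriples≤numClasses [] = z≤n
    sideTriples≤numClasses (t ∷ ts)
      with Any.any? (λ s → Congruent? t s) ts | Any.any? (λ s → sides t ≟ˢ sides s) ts
    ... | yes _         | yes _      = sideTriples≤numClasses ts
    ... | yes congruent | no unequal = ⊥-elim (unequal (Any.map congruent⇒same-sides congruent))
    ... | no _          | yes _      = m≤n⇒m≤1+n (sideTriples≤numClasses ts)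
    ... | no _          | no _       = s≤s (sideTriples≤numClasses ts)

    ∈-sideTriples : ∀ {t ts} → t ∈ ts → sides t ∈ sideTriples ts
    ∈-sideTriples {t} {u ∷ ts} (here refl) with Any.any? (λ s → sides u ≟ˢ sides s) ts
    ... | yes later = let s , s∈ts , same = find later
                      in subst (_∈ sideTriples ts) (sym same) (∈-sideTriples s∈ts)
    ... | no _      = here refl
    ∈-sideTriples {t} {u ∷ ts} (there t∈ts) with Any.any? (λ s → sides u ≟ˢ sides s) ts
    ... | yes _ = ∈-sideTriples t∈ts
    ... | no _  = there (∈-sideTriples t∈ts)

module Counting where

  open import Defs using (InSq?; allPoints)

  open import Data.Nat using (zero; suc; _+_; _*_; _≤_; z≤n; s≤s)
  open import Data.Nat.Properties as ℕP using (+-suc; *-suc; +-mono-≤)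
  open import Data.Fin as F using (Fin)
  open import Data.Fin.Subset using (Subset; ∣_∣; inside; outside) renaming (_∈_ to _∈ₛ_)
  open import Data.Fin.Subset.Properties using (_∈?_)
  open import Data.Product using (Σ; _×_; _,_; proj₁)
  open import Data.Sum using (_⊎_; inj₁; inj₂)
  open import Data.Empty using (⊥-elim)
  open import Data.List using (List; []; _∷_; length; filter; allFin; tabulate; map; cartesianProduct)
  open import Data.List.Properties using (length-++; length-map; filter-++)
  open import Data.Bool using (true; false)
  open import Data.List.Relation.Unary.Any using (here; there)
  open import Data.List.Relation.Unary.All as All using (All; []; _∷_)
  open import Data.List.Relation.Unary.AllPairs using (_∷_)
  open import Data.List.Relation.Unary.Unique.Propositional using (Unique)
  import Data.List.Relation.Unary.Unique.Propositional.Properties as Unique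
  open import Data.List.Membership.Propositional using (_∈_)
  open import Data.List.Membership.Propositional.Properties using (∈-filter⁻)
  open import Data.Vec using ([]; _∷_)
  open import Function using (_∘_; id)
  open import Relation.Nullary using (¬_; yes; no; ¬?; does)
  open import Relation.Unary using (Decidable)
  open import Relation.Binary.Definitions using (DecidableEquality)
  open import Relation.Binary.PropositionalEquality

  length-filter-split : ∀ {A : Set} {P : A → Set} (P? : Decidable P) xs →
    length xs ≡ length (filter P? xs) + length (filter (¬? ∘ P?) xs)
  length-filter-split P? [] = refl
  length-filter-split P? (x ∷ xs) with P? x
  ... | yes _ = cong suc (length-filter-split P? xs)
  ... | no _  = trans (cong suc (length-filter-split P? xs)) (sym (+-suc _ _))

  length-filter-∷ : ∀ {A : Set} {P : A → Set} (P? : Decidable P) x xs →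
    length (filter P? (x ∷ xs)) ≤ suc (length (filter P? xs))
  length-filter-∷ P? x xs with does (P? x)
  ... | true  = ℕP.≤-refl
  ... | false = ℕP.n≤1+n _

  two-distinct : ∀ {A : Set} {xs : List A} → Unique xs → 2 ≤ length xs →
                 Σ A λ a → Σ A λ b → a ∈ xs × b ∈ xs × ¬ a ≡ b
  two-distinct {xs = a ∷ b ∷ _} ((a≢b ∷ _) ∷ _) _ = a , b , here refl , there (here refl) , a≢b
  two-distinct {xs = _ ∷ []} _ (s≤s ())

  length-cartesianProduct : ∀ {A B : Set} (xs : List A) (ys : List B) →
    length (cartesianProduct xs ys) ≡ length xs * length ys
  length-cartesianProduct [] ys = refl
  length-cartesianProduct (x ∷ xs) ys =
    trans (length-++ (map (x ,_) ys)) (cong₂ _+_ (length-map (x ,_) ys) (length-cartesianProduct xs ys))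

  module TwoToOne {X Y : Set} (_≟_ : DecidableEquality Y) (g : X → Y) where

    AtMostTwoToOne : List X → Set
    AtMostTwoToOne M = ∀ {a b c} → a ∈ M → b ∈ M → c ∈ M →
                       g a ≡ g b → g a ≡ g c → a ≡ b ⊎ a ≡ c ⊎ b ≡ c

    restrict : ∀ {M N} → (∀ {x} → x ∈ N → x ∈ M) → AtMostTwoToOne M → AtMostTwoToOne N
    restrict N⊆M two a b c = two (N⊆M a) (N⊆M b) (N⊆M c)

    fiber-≤2 : ∀ {M} v F → Unique F → AtMostTwoToOne M →
               (∀ {x} → x ∈ F → x ∈ M × g x ≡ v) → length F ≤ 2
    fiber-≤2 v [] _ _ _ = z≤n
    fiber-≤2 v (_ ∷ []) _ _ _ = s≤s z≤n
    fiber-≤2 v (_ ∷ _ ∷ []) _ _ _ = s≤s (s≤s z≤n)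
    fiber-≤2 v (a ∷ b ∷ c ∷ F) ((a≢b ∷ a≢c ∷ _) ∷ (b≢c ∷ _) ∷ _) two inF
      with inF (here refl) | inF (there (here refl)) | inF (there (there (here refl)))
    ... | a∈ , ga | b∈ , gb | c∈ , gc with two a∈ b∈ c∈ (trans ga (sym gb)) (trans ga (sym gc))
    ...   | inj₁ a≡b        = ⊥-elim (a≢b a≡b)
    ...   | inj₂ (inj₁ a≡c) = ⊥-elim (a≢c a≡c)
    ...   | inj₂ (inj₂ b≡c) = ⊥-elim (b≢c b≡c)

    length-≤-2* : ∀ U M → Unique M → AtMostTwoToOne M → All (λ x → g x ∈ U) M →
                  length M ≤ 2 * length U
    length-≤-2* [] [] _ _ _ = z≤n
    length-≤-2* [] (x ∷ M) _ _ (() ∷ _)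
    length-≤-2* (u ∷ U) M uniq two into = begin
      length M                                      ≡⟨ length-filter-split fiber? M ⟩
      length (filter fiber? M) + length rest        ≤⟨ +-mono-≤ fiber≤2 rest≤ ⟩
      2 + 2 * length U                              ≡⟨ sym (*-suc 2 (length U)) ⟩
      2 * length (u ∷ U)                            ∎
      where
      open ℕP.≤-Reasoning
      fiber? : Decidable (λ x → g x ≡ u)
      fiber? x = g x ≟ u
      rest = filter (¬? ∘ fiber?) M
      fiber≤2 : length (filter fiber? M) ≤ 2
      fiber≤2 = fiber-≤2 u (filter fiber? M) (Unique.filter⁺ fiber? uniq) two (∈-filter⁻ fiber?)
      rest-into : All (λ x → g x ∈ U) rest
      rest-into = All.tabulate λ x∈ → let x∈M , gx≢u = ∈-filter⁻ (¬? ∘ fiber?) x∈ in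
        drop-head gx≢u (All.lookup into x∈M)
        where
        drop-head : ∀ {y} → ¬ y ≡ u → y ∈ u ∷ U → y ∈ U
        drop-head y≢u (here y≡u) = ⊥-elim (y≢u y≡u)
        drop-head _   (there y∈U) = y∈U
      rest≤ : length rest ≤ 2 * length U
      rest≤ = length-≤-2* U rest (Unique.filter⁺ (¬? ∘ fiber?) uniq)
                (restrict (proj₁ ∘ ∈-filter⁻ (¬? ∘ fiber?)) two) rest-into

  module SubsetCount where
    members : ∀ {n} → Subset n → List (Fin n)
    members {n} A = filter (_∈? A) (allFin n)

    private
      shift : ∀ {n m} b (B : Subset m) (h : Fin n → Fin m) →
        length (filter (_∈? (b ∷ B)) (tabulate (F.suc ∘ h))) ≡ length (filter (_∈? B) (tabulate h))
      shift {zero} b B h = refl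
      shift {suc n} b B h with h F.zero ∈? B
      ... | yes _ = cong suc (shift b B (h ∘ F.suc))
      ... | no _  = shift b B (h ∘ F.suc)

    length-members : ∀ {n} (A : Subset n) → length (members A) ≡ ∣ A ∣
    length-members [] = refl
    length-members (inside ∷ A)  = cong suc (trans (shift inside A id) (length-members A))
    length-members (outside ∷ A) = trans (shift outside A id) (length-members A)

    module _ {n} (A : Subset n) where
      private
        row-in : ∀ {x} → x ∈ₛ A → ∀ ys →
                 length (filter (InSq? A) (map (x ,_) ys)) ≡ length (filter (_∈? A) ys)
        row-in x∈A [] = refl
        row-in {x} x∈A (y ∷ ys) with x ∈? A | y ∈? A
        ... | yes _  | yes _ = cong suc (row-in x∈A ys)
        ... | yes _  | no _  = row-in x∈A ys
        ... | no x∉A | _     = ⊥-elim (x∉A x∈A)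

        row-out : ∀ {x} → ¬ x ∈ₛ A → ∀ ys → length (filter (InSq? A) (map (x ,_) ys)) ≡ 0
        row-out x∉A [] = refl
        row-out {x} x∉A (y ∷ ys) with x ∈? A
        ... | yes x∈A = ⊥-elim (x∉A x∈A)
        ... | no _    = row-out x∉A ys

        split-row : ∀ x xs ys → length (filter (InSq? A) (cartesianProduct (x ∷ xs) ys)) ≡
          length (filter (InSq? A) (map (x ,_) ys)) + length (filter (InSq? A) (cartesianProduct xs ys))
        split-row x xs ys = trans (cong length (filter-++ (InSq? A) (map (x ,_) ys) (cartesianProduct xs ys)))
                                  (length-++ (filter (InSq? A) (map (x ,_) ys)))

      length-filter-InSq : ∀ xs ys → length (filter (InSq? A) (cartesianProduct xs ys)) ≡
                           length (filter (_∈? A) xs) * length (filter (_∈? A) ys)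
      length-filter-InSq [] ys = refl
      length-filter-InSq (x ∷ xs) ys with x ∈? A
      ... | yes x∈A = trans (split-row x xs ys) (cong₂ _+_ (row-in x∈A ys) (length-filter-InSq xs ys))
      ... | no x∉A  = trans (split-row x xs ys) (cong₂ _+_ (row-out x∉A ys) (length-filter-InSq xs ys))

      length-square : length (filter (InSq? A) (allPoints n)) ≡ ∣ A ∣ * ∣ A ∣
      length-square = trans (length-filter-InSq (allFin n) (allFin n))
                            (cong₂ _*_ (length-members A) (length-members A))

  module Estimate where
    open import Data.Integer as ℤ using (+_; +≤+; -≤+)
    import Data.Integer.Properties as ℤP
    open import Data.Nat using (_∸_)

    estimate-ℕ : ∀ N Δ K T → 1 ≤ K → K * N ≤ 2 * T → Δ ≤ suc K → (N ∸ 2) * Δ ≤ 6 * T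
    estimate-ℕ N Δ K T K≥1 KN≤2T Δ≤1+K = begin
      (N ∸ 2) * Δ       ≤⟨ ℕP.*-mono-≤ (ℕP.m∸n≤m N 2) Δ≤1+K ⟩
      N * suc K         ≡⟨ ℕP.*-suc N K ⟩
      N + N * K         ≡⟨ cong (_+ N * K) (sym (ℕP.*-identityʳ N)) ⟩
      N * 1 + N * K     ≤⟨ ℕP.+-monoˡ-≤ (N * K) (ℕP.*-monoʳ-≤ N K≥1) ⟩
      N * K + N * K     ≡⟨ cong (λ m → m + m) (ℕP.*-comm N K) ⟩
      K * N + K * N     ≤⟨ +-mono-≤ KN≤2T KN≤2T ⟩
      2 * T + 2 * T     ≡⟨ sym (ℕP.*-distribʳ-+ T 2 2) ⟩
      4 * T             ≤⟨ ℕP.*-monoˡ-≤ T {4} {6} (s≤s (s≤s (s≤s (s≤s z≤n)))) ⟩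
      6 * T             ∎
      where open ℕP.≤-Reasoning

    estimate : ∀ n Δ K T → K * (n * n) ≤ 2 * T → Δ ≤ suc K → (2 ≤ n → 1 ≤ K) →
               (+ (n * n) ℤ.- + 2) ℤ.* + Δ ℤ.≤ + (6 * T)
    estimate 0 zero _ _ _ _ _ = +≤+ z≤n
    estimate 0 (suc _) _ _ _ _ _ = -≤+
    estimate 1 zero _ _ _ _ _ = +≤+ z≤n
    estimate 1 (suc _) _ _ _ _ _ = -≤+
    estimate n@(suc (suc _)) Δ K T KN≤2T Δ≤1+K K≥1 =
      subst (ℤ._≤ + (6 * T)) (sym lhs-in-ℕ)
        (+≤+ (estimate-ℕ (n * n) Δ K T (K≥1 (s≤s (s≤s z≤n))) KN≤2T Δ≤1+K))
      where
      lhs-in-ℕ : (+ (n * n) ℤ.- + 2) ℤ.* + Δ ≡ + ((n * n ∸ 2) * Δ)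
      lhs-in-ℕ = trans (cong (ℤ._* + Δ) (trans (ℤP.[+m]-[+n]≡m⊖n (n * n) 2) (ℤP.⊖-≥ (s≤s (s≤s z≤n)))))
                       (sym (ℤP.pos-* (n * n ∸ 2) Δ))

module PrimeField (q : ℕ) (p-prime : Prime (suc q)) (p≢2 : suc q ≢ 2) where
  open IntegerPlane
  open ResidueArithmetic
  open Counting
  open import Defs
  open import Data.Nat using (ℕ; suc; _*_; _≤_; _%_)
  open import Data.Nat.Properties using (*-monoʳ-≤; module ≤-Reasoning)
  open import Data.Nat.DivMod using (m%n<n; m%n%n≡m%n; m<n⇒m%n≡m)
  open import Data.Nat.Divisibility using (_∣_)
  open import Data.Nat.Primality using (Prime; euclidsLemma; irreducible[2]; ¬prime[1])
  open import Data.Integer as ℤ using (ℤ; +_)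
  open import Data.Integer.Properties using (abs-*; +-identityʳ)
  open import Data.Integer.Divisibility.Signed using (∣ᵤ⇒∣; ∣⇒∣ᵤ)
  open import Data.Integer.Tactic.RingSolver using (solve-∀)
  open import Data.Fin as F using (Fin; toℕ)
  open import Data.Fin.Properties using (toℕ-injective; toℕ<n; toℕ-fromℕ<; suc-injective)
  open import Data.Fin.Subset using (Subset; ∣_∣) renaming (_∈_ to _∈ₛ_)
  open import Data.Fin.Subset.Properties using (_∈?_)
  open import Data.Product using (_×_; _,_; proj₁; proj₂)
  open import Data.Sum as Sum using (_⊎_; inj₁; inj₂; [_,_]′)
  open import Data.Empty using (⊥-elim)
  open import Data.List using (List; length; filter; tabulate; allFin; cartesianProduct)
  open import Data.List.Relation.Unary.All as All using (All)
  open import Data.List.Relation.Unary.Unique.Propositional using (Unique)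
  import Data.List.Relation.Unary.Unique.Propositional.Properties as Unique
  open import Data.List.Membership.Propositional using (_∈_; lose)
  open import Data.List.Properties using (filter-some)
  open import Data.List.Membership.Propositional.Properties
    using (∈-filter⁺; ∈-filter⁻; ∈-cartesianProduct⁺; ∈-cartesianProduct⁻; ∈-allFin; ∈-tabulate⁺; ∈-tabulate⁻)
  open import Function using (_∘_; id)
  open import Relation.Nullary using (¬_; yes; no)
  open import Relation.Binary.PropositionalEquality

  p : ℕ
  p = suc q

  open Ideal (+ p)
  open Residues p

  euclid : ∀ x y → x ℤ.* y ≡0 → x ≡0 ⊎ y ≡0
  euclid x y h = Sum.map ∣ᵤ⇒∣ ∣ᵤ⇒∣ (euclidsLemma ℤ.∣ x ∣ ℤ.∣ y ∣ p-prime (subst (p ∣_) (abs-* x y) (∣⇒∣ᵤ h)))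

  p∤2 : ¬ (+ 2 ≡0)
  p∤2 h with irreducible[2] (∣⇒∣ᵤ h)
  ... | inj₁ p≡1 = ¬prime[1] (subst Prime p≡1 p-prime)
  ... | inj₂ p≡2 = p≢2 p≡2

  open TwoCircles (+ p) euclid p∤2

  %≡0⇒dist²≡0 : ∀ x y → dist x y % p ≡ 0 → dist² (ι² x) (ι² y) ≡0
  %≡0⇒dist²≡0 x y e =
    by (trans (+-identityʳ (+ dist x y)) (dist-ι x y)) (mod⇒≈ (dist x y) 0 (%⇒mod (dist x y) 0 e))

  dist²≡0⇒%≡0 : ∀ x y → dist² (ι² x) (ι² y) ≡0 → dist x y % p ≡ 0
  dist²≡0⇒%≡0 x y h =
    mod⇒% (dist x y) 0 (≈⇒mod (dist x y) 0 (by (sym (trans (+-identityʳ (+ dist x y)) (dist-ι x y))) h))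

  distinct⇒dist≢0 : ∀ {a b} c → a ≢ b → ¬ dist (a , c) (b , c) % p ≡ 0
  distinct⇒dist≢0 {a} {b} c a≢b e = a≢b (ι-injective a b ([ id , id ]′ (euclid _ _ square≡0)))
    where
    identity : ∀ u w → u ℤ.* u ℤ.+ (w ℤ.- w) ℤ.* (w ℤ.- w) ≡ u ℤ.* u
    identity = solve-∀
    square≡0 : (ι a ℤ.- ι b) ℤ.* (ι a ℤ.- ι b) ≡0
    square≡0 = by (identity (ι a ℤ.- ι b) (ι c)) (%≡0⇒dist²≡0 (a , c) (b , c) e)

  at-most-two : ∀ x y a b c → ¬ dist² (ι² x) (ι² y) ≡0 →
    dist x a % p ≡ dist x b % p → dist y a % p ≡ dist y b % p →
    dist x a % p ≡ dist x c % p → dist y a % p ≡ dist y c % p →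
    a ≡ b ⊎ a ≡ c ⊎ b ≡ c
  at-most-two x@(x₁ , x₂) y@(y₁ , y₂) a b c x≉y xab yab xac yac =
    Sum.map (point-eq a b) (Sum.map (point-eq a c) (point-eq b c))
      (Centres.three-points (ι x₁) (ι x₂) (ι y₁) (ι y₂) x≉y (ι² a) (ι² b) (ι² c)
        (%⇒dist²≈ x a x b xab) (%⇒dist²≈ y a y b yab) (%⇒dist²≈ x a x c xac) (%⇒dist²≈ y a y c yac))
    where
    point-eq : ∀ u v → ι² u ≈² ι² v → u ≡ v
    point-eq (u₁ , u₂) (v₁ , v₂) (h₁ , h₂) = cong₂ _,_ (ι-injective u₁ v₁ h₁) (ι-injective u₂ v₂ h₂)

  module Configuration (A : Subset p) where
    open SubsetCount

    nonzeroΔ : List (Fin p)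
    nonzeroΔ = filter (InΔ? A) (tabulate F.suc)

    Realises : Fin p → Point p × Point p → Set
    Realises d (x , y) = InSq A x × InSq A y × dist x y ≡ toℕ d [mod p ]

    -- a chord of length d, chosen for every d ∈ Δ (arbitrary otherwise)
    chord : Fin p → Point p × Point p
    chord d with InΔ? A d
    ... | yes (x , y , _) = x , y
    ... | no _            = (F.zero , F.zero) , (F.zero , F.zero)

    chord₁ chord₂ : Fin p → Point p
    chord₁ = proj₁ ∘ chord
    chord₂ = proj₂ ∘ chord

    chord-realises : ∀ d → InΔ A d → Realises d (chord d)
    chord-realises d d∈Δ with InΔ? A d
    ... | yes (_ , _ , r) = r
    ... | no d∉Δ          = ⊥-elim (d∉Δ d∈Δ)

    ∈nonzeroΔ⁻ : ∀ {d} → d ∈ nonzeroΔ → InΔ A d × toℕ d ≢ 0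
    ∈nonzeroΔ⁻ d∈ with ∈-filter⁻ (InΔ? A) d∈
    ... | d∈suc , d∈Δ with ∈-tabulate⁻ {f = F.suc} d∈suc
    ...   | _ , refl = d∈Δ , λ ()

    chord-length : ∀ {d} → d ∈ nonzeroΔ → dist (chord₁ d) (chord₂ d) % p ≡ toℕ d
    chord-length {d} d∈ = trans (mod⇒% (dist (chord₁ d) (chord₂ d)) (toℕ d) length≡d) (m<n⇒m%n≡m (toℕ<n d))
      where
      length≡d = proj₂ (proj₂ (chord-realises d (proj₁ (∈nonzeroΔ⁻ d∈))))

    chord-nondegenerate : ∀ {d} → d ∈ nonzeroΔ → ¬ dist² (ι² (chord₁ d)) (ι² (chord₂ d)) ≡0
    chord-nondegenerate {d} d∈ h =
      proj₂ (∈nonzeroΔ⁻ d∈) (trans (sym (chord-length d∈)) (dist²≡0⇒%≡0 (chord₁ d) (chord₂ d) h))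

    apex : Fin p × Point p → Triangle p
    apex (d , z) = chord₁ d , chord₂ d , z

    open TwoToOne _≟ˢ_ (sides ∘ apex)

    points : List (Point p)
    points = filter (InSq? A) (allPoints p)

    pairs : List (Fin p × Point p)
    pairs = cartesianProduct nonzeroΔ points

    same-chord : ∀ {d d′ z z′} → (d , z) ∈ pairs → (d′ , z′) ∈ pairs →
                 sides (apex (d , z)) ≡ sides (apex (d′ , z′)) → d ≡ d′
    same-chord {d} {d′} m m′ e = toℕ-injective (begin
      toℕ d                             ≡⟨ sym (chord-length (proj₁ (∈-cartesianProduct⁻ _ _ m))) ⟩
      dist (chord₁ d) (chord₂ d) % p     ≡⟨ cong proj₁ e ⟩
      dist (chord₁ d′) (chord₂ d′) % p   ≡⟨ chord-length (proj₁ (∈-cartesianProduct⁻ _ _ m′)) ⟩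
      toℕ d′                            ∎)
      where open ≡-Reasoning

    apex-two-to-one : AtMostTwoToOne pairs
    apex-two-to-one {d₁ , z₁} {d₂ , z₂} {d₃ , z₃} m₁ m₂ m₃ e₁₂ e₁₃ =
      common-chord (same-chord m₁ m₂ e₁₂) (same-chord m₁ m₃ e₁₃) e₁₂ e₁₃
      where
      -- with a common chord, the three apexes lie on two circles about its ends
      common-chord : d₁ ≡ d₂ → d₁ ≡ d₃ →
        sides (apex (d₁ , z₁)) ≡ sides (apex (d₂ , z₂)) → sides (apex (d₁ , z₁)) ≡ sides (apex (d₃ , z₃)) →
        (d₁ , z₁) ≡ (d₂ , z₂) ⊎ (d₁ , z₁) ≡ (d₃ , z₃) ⊎ (d₂ , z₂) ≡ (d₃ , z₃)
      common-chord refl refl e₁₂ e₁₃ =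
        Sum.map (cong (d₁ ,_)) (Sum.map (cong (d₁ ,_)) (cong (d₁ ,_)))
          (at-most-two (chord₁ d₁) (chord₂ d₁) z₁ z₂ z₃
            (chord-nondegenerate (proj₁ (∈-cartesianProduct⁻ _ _ m₁)))
            (cong (proj₁ ∘ proj₂) e₁₂) (cong (proj₂ ∘ proj₂) e₁₂)
            (cong (proj₁ ∘ proj₂) e₁₃) (cong (proj₂ ∘ proj₂) e₁₃))

    unique-pairs : Unique pairs
    unique-pairs = Unique.cartesianProduct⁺
      (Unique.filter⁺ (InΔ? A) (Unique.tabulate⁺ suc-injective))
      (Unique.filter⁺ (InSq? A) (Unique.cartesianProduct⁺ (Unique.allFin⁺ p) (Unique.allFin⁺ p)))

    ∈points : ∀ {z} → InSq A z → z ∈ points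
    ∈points {z₁ , z₂} z∈A = ∈-filter⁺ (InSq? A) (∈-cartesianProduct⁺ (∈-allFin z₁) (∈-allFin z₂)) z∈A

    apex-sides : All (λ t → sides (apex t) ∈ sideTriples (triangles p A)) pairs
    apex-sides = All.tabulate λ {(d , z)} m →
      let d∈ , z∈ = ∈-cartesianProduct⁻ nonzeroΔ points m
          x∈A , y∈A , _ = chord-realises d (proj₁ (∈nonzeroΔ⁻ d∈))
      in ∈-sideTriples (∈-cartesianProduct⁺ (∈points x∈A) (∈-cartesianProduct⁺ (∈points y∈A) z∈))

    pairs-bound : length nonzeroΔ * (∣ A ∣ * ∣ A ∣) ≤ 2 * numT p A
    pairs-bound = begin
      length nonzeroΔ * (∣ A ∣ * ∣ A ∣)             ≡⟨ cong (length nonzeroΔ *_) (sym (length-square A)) ⟩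
      length nonzeroΔ * length points              ≡⟨ sym (length-cartesianProduct nonzeroΔ points) ⟩
      length pairs                                 ≤⟨ length-≤-2* _ pairs unique-pairs apex-two-to-one apex-sides ⟩
      2 * length (sideTriples (triangles p A))     ≤⟨ *-monoʳ-≤ 2 (sideTriples≤numClasses (triangles p A)) ⟩
      2 * numT p A                                 ∎
      where open ≤-Reasoning

    -- besides the nonzero distances, Δ contains at most 0
    Δ-bound : numΔ p A ≤ suc (length nonzeroΔ)
    Δ-bound = length-filter-∷ (InΔ? A) F.zero (tabulate F.suc)

    distinct⇒nonzeroΔ-nonempty : ∀ {a b} → a ∈ₛ A → b ∈ₛ A → a ≢ b → 1 ≤ length nonzeroΔ
    distinct⇒nonzeroΔ-nonempty {a} {b} a∈A b∈A a≢b =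
      filter-some (InΔ? A) (lose (nonzero∈ d d≢0) d∈Δ)
      where
      n = dist (a , a) (b , a)
      d : Fin p
      d = F.fromℕ< (m%n<n n p)
      toℕ-d : toℕ d ≡ n % p
      toℕ-d = toℕ-fromℕ< (m%n<n n p)
      d∈Δ : InΔ A d
      d∈Δ = (a , a) , (b , a) , (a∈A , a∈A) , (b∈A , a∈A) ,
            %⇒mod n (toℕ d) (sym (trans (cong (_% p) toℕ-d) (m%n%n≡m%n n p)))
      d≢0 : toℕ d ≢ 0
      d≢0 e = distinct⇒dist≢0 a a≢b (trans (sym toℕ-d) e)
      nonzero∈ : ∀ i → toℕ i ≢ 0 → i ∈ tabulate F.suc
      nonzero∈ F.zero    i≢0 = ⊥-elim (i≢0 refl)
      nonzero∈ (F.suc i) _   = ∈-tabulate⁺ i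

    nonzeroΔ-nonempty : 2 ≤ ∣ A ∣ → 1 ≤ length nonzeroΔ
    nonzeroΔ-nonempty |A|≥2 =
      let a , b , a∈ , b∈ , a≢b = two-distinct (Unique.filter⁺ (_∈? A) (Unique.allFin⁺ p))
                                               (subst (2 ≤_) (sym (length-members A)) |A|≥2)
      in distinct⇒nonzeroΔ-nonempty (∈members⁻ a∈) (∈members⁻ b∈) a≢b
      where
      ∈members⁻ : ∀ {a} → a ∈ members A → a ∈ₛ A
      ∈members⁻ a∈ = proj₂ (∈-filter⁻ (_∈? A) {xs = allFin p} a∈)

open import Defs
open import Data.Nat using (zero; _*_)
open import Data.Nat.Primality using (¬prime[0])
open import Data.Fin.Subset using (Subset; ∣_∣)
open import Data.Integer using (+_; _-_; _≤_)
import Data.Integer as ℤ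
open import Data.List using (length)
open import Data.Empty using (⊥-elim)

lemma4 : (p : ℕ) → Prime p → p ≢ 2 → (A : Subset p) →
    (+ (∣ A ∣ * ∣ A ∣) - + 2) ℤ.* + numΔ p A ≤ + (6 * numT p A)
lemma4 zero    p-prime = ⊥-elim (¬prime[0] p-prime)
lemma4 (suc q) p-prime p≢2 A =
  estimate ∣ A ∣ (numΔ (suc q) A) (length nonzeroΔ) (numT (suc q) A) pairs-bound Δ-bound nonzeroΔ-nonempty
  where
  open Counting.Estimate using (estimate)
  open PrimeField.Configuration q p-prime p≢2 A
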